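{- Let $n\ge1$. An ascent sequence $x=(x_1,\dots,x_n)\in\mathrm{Asc}(n)$ satisfies $x=\Gamma(A)$ for some bidiagonal $A\in\mathrm{Int}(n)$ if and only if $x_i\ge\mathrm{asc}_i(x)-1$ for all $1\le i\le n$.
   Context: $\mathrm{Int}(n)$ is the set of upper triangular square matrices with non-negative integer entries summing to $n$ such that every row and column has a non-zero entry. A square matrix $A$ is bidiagonal if $A_{i,j}=0$ whenever $j\notin\{i,i+1\}$. For such $A$: $\dim(A)$ is the number of rows, $\mathrm{index}(A)$ the smallest $i$ with $A_{i,\dim(A)}>0$, $\mathrm{val}(A)=A_{\mathrm{index}(A),\dim(A)}$. For a sequence $y$, $\mathrm{asc}(y)$ is the number of $i$ with $y_i<y_{i+1}$, and $\mathrm{asc}_k(y)=\mathrm{asc}(y_1,\dots,y_k)$. $\mathrm{Asc}(n)$ is the set of integer sequences $(x_1,\dots,x_n)$ with $x_1=0$ and $x_i\in[0,1+\mathrm{asc}(x_1,\dots,x_{i-1})]$ for $1<i\le n$. Removal operation $f$ on $A\in\mathrm{Int}(n)$, $n\ge2$: (Rem1) if $\mathrm{val}(A)>1$, or if $\mathrm{val}(A)=1$, $\mathrm{index}(A)<\dim(A)$ and row $\mathrm{index}(A)$ has another positive entry, decrease entry $(\mathrm{index}(A),\dim(A))$ by $1$; (Rem2) if $\mathrm{val}(A)=1$ and $\mathrm{index}(A)=\dim(A)$, delete last row and column; (Rem3) if $\mathrm{val}(A)=1$, $\mathrm{index}(A)<\dim(A)$ and all other entries of row $\mathrm{index}(A)$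 are $0$, set $A_{i,\dim(A)}:=A_{i,\mathrm{index}(A)}$ for $1\le i\le\mathrm{index}(A)-1$, then delete row and column $\mathrm{index}(A)$. $\Gamma:\mathrm{Int}(n)\to\mathrm{Asc}(n)$ (a bijection): $\Gamma((1))=(0)$ and for $n\ge2$, $\Gamma(A)$ is $\Gamma(f(A))$ with $\mathrm{index}(A)-1$ appended. -}

module Defs where

open import Data.Nat using (ℕ; zero; suc; _+_; _∸_; _≤_; _<_; _<?_)
open import Data.Fin using (Fin; toℕ; fromℕ; inject₁; punchIn; _≟_)
import Data.Fin as F
open import Data.List using (List; []; _∷_; _++_; [_]; length; lookup; take)
open import Data.Maybe using (Maybe; just; nothing)
import Data.Maybe as M
open import Data.Bool using (Bool; true; false; if_then_else_; _∧_)
open import Data.Product using (_×_)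
open import Relation.Nullary using (does; ¬_)
open import Relation.Binary.PropositionalEquality using (_≡_; _≢_)

record Mat : Set where
  constructor mat
  field
    dim : ℕ
    ent : Fin dim → Fin dim → ℕ
open Mat public

∑ : ∀ {k} → (Fin k → ℕ) → ℕ
∑ {zero}  v = 0
∑ {suc k} v = v F.zero + ∑ (λ j → v (F.suc j))

entrySum : Mat → ℕ
entrySum A = ∑ (λ i → ∑ (λ j → ent A i j))

InInt : ℕ → Mat → Set
InInt n A =
  (∀ i j → toℕ j < toℕ i → ent A i j ≡ 0) ×
  (entrySum A ≡ n) ×
  (∀ i → ¬ (∀ j → ent A i j ≡ 0)) ×
  (∀ j → ¬ (∀ i → ent A i j ≡ 0))

Bidiagonal : Mat → Set
Bidiagonal A = ∀ i j → toℕ j ≢ toℕ i → toℕ j ≢ suc (toℕ i) → ent A i j ≡ 0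

firstPos : ∀ {k} → (Fin k → ℕ) → Maybe (Fin k)
firstPos {zero}  v = nothing
firstPos {suc k} v with v F.zero
... | zero  = M.map F.suc (firstPos (λ j → v (F.suc j)))
... | suc _ = just F.zero

-- 0-based index(A) (= index(A) - 1 in the paper's 1-based convention),
-- for a matrix of dimension suc m; defaults to the last index if the
-- last column is zero (never happens for matrices in Int(n)).
index0 : (m : ℕ) → (Fin (suc m) → Fin (suc m) → ℕ) → Fin (suc m)
index0 m a with firstPos (λ i → a i (fromℕ m))
... | just i  = i
... | nothing = fromℕ m

eqF : ∀ {k} → Fin k → Fin k → Bool
eqF i j = does (i ≟ j)

decr : (m : ℕ) → (Fin (suc m) → Fin (suc m) → ℕ) → Fin (suc m) → Mat
decr m a i = mat (suc m) (λ r c → if eqF r i ∧ eqF c (fromℕ m) then a r c ∸ 1 else a r c)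

delLast : (m : ℕ) → (Fin (suc m) → Fin (suc m) → ℕ) → Mat
delLast m a = mat m (λ r c → a (inject₁ r) (inject₁ c))

-- Rem3: set A_{r,last} := A_{r,i} for r < i, then delete row and column i
rem3 : (m : ℕ) → (Fin (suc m) → Fin (suc m) → ℕ) → Fin (suc m) → Mat
rem3 m a i = mat m (λ r c →
  if eqF (punchIn i c) (fromℕ m) ∧ does (toℕ (punchIn i r) <? toℕ i)
  then a (punchIn i r) i
  else a (punchIn i r) (punchIn i c))

otherPos : (m : ℕ) → (Fin (suc m) → Fin (suc m) → ℕ) → Fin (suc m) → Bool
otherPos m a i with firstPos (λ j → if eqF j (fromℕ m) then 0 else a i j)
... | just _  = true
... | nothing = false

fStep : (m : ℕ) → (Fin (suc m) → Fin (suc m) → ℕ) → Fin (suc m) → ℕ → Mat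
fStep m a i zero = mat (suc m) a   -- val = 0: impossible for Int(n)
fStep m a i (suc zero) =
  if eqF i (fromℕ m) then delLast m a
  else (if otherPos m a i then decr m a i else rem3 m a i)
fStep m a i (suc (suc _)) = decr m a i

f : Mat → Mat
f (mat zero a)    = mat zero a
f (mat (suc m) a) = fStep m a (index0 m a) (a (index0 m a) (fromℕ m))

indexMinus1 : Mat → ℕ
indexMinus1 (mat zero a)    = 0
indexMinus1 (mat (suc m) a) = toℕ (index0 m a)

Γ : ℕ → Mat → List ℕ
Γ zero A = []
Γ (suc zero) A = 0 ∷ []
Γ (suc (suc k)) A = Γ (suc k) (f A) ++ [ indexMinus1 A ]

asc : List ℕ → ℕ
asc [] = 0
asc (a ∷ []) = 0
asc (a ∷ b ∷ r) = (if does (a <? b) then 1 else 0) + asc (b ∷ r)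

ascPrefix : ℕ → List ℕ → ℕ
ascPrefix k y = asc (take k y)

-- Asc(n); the 0-based position i corresponds to the paper's x_{i+1}
InAsc : ℕ → List ℕ → Set
InAsc n x =
  (length x ≡ n) ×
  (∀ (i : Fin (length x)) →
     (toℕ i ≡ 0 → lookup x i ≡ 0) ×
     (toℕ i ≢ 0 → lookup x i ≤ 1 + ascPrefix (toℕ i) x))

module Submission where

-- A bidiagonal matrix is a sequence of columns, each new column contributing a
-- superdiagonal entry s and a diagonal entry d.  On such matrices f only changes the last
-- two columns, and each of Rem1–Rem3 becomes a local move on them; the letter that Γ
-- appends is the 0-based row of the topmost positive entry of the last column, which is
-- dim A − 1 or dim A − 2.  By induction along Γ, asc (Γ A) = dim A − 1, so every letter is
-- at least the current number of ascents minus one: this is the bound x_i ≥ asc_i(x) − 1.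
-- Conversely, if Γ A = xs, the letters allowed after xs by the ascent-sequence condition
-- and the bound are exactly dim A − 2, dim A − 1 and dim A, and each of them is appended
-- by Γ to a matrix obtained from A by an inverse move, so every such sequence is reached.

open import Defs
open import Data.Nat using (ℕ; zero; suc; pred; _+_; _∸_; _≤_; _<_; z≤n; s≤s; _≟_; _<?_)
import Data.Nat.Properties as NP
open import Data.Nat.Tactic.RingSolver using (solve-∀)
open import Data.Fin using (Fin; toℕ; fromℕ; fromℕ<; inject₁; punchIn)
import Data.Fin as F
import Data.Fin.Properties as FP
open import Data.List
  using (List; []; _∷_; _++_; [_]; _∷ʳ_; length; lookup; take; last; initLast; _∷ʳ′_)
import Data.List.Properties as LP
open import Data.Maybe using (just; nothing)
import Data.Maybe as M
open import Data.Bool using (Bool; true; false; if_then_else_; _∧_)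
open import Data.Product using (_×_; _,_; ∃; proj₁; proj₂)
open import Data.Sum using (inj₁; inj₂)
open import Data.Empty using (⊥; ⊥-elim)
open import Function using (_∘_)
open import Function.Bundles using (_⇔_; mk⇔; module Equivalence)
open import Relation.Nullary using (yes; no; does; ¬_)
open import Relation.Nullary.Decidable using (dec-true; dec-false)
open import Relation.Binary.PropositionalEquality hiding ([_])

infix 4 _≋_

data _≋_ : Mat → Mat → Set where
  pointwise : ∀ {d} {a b : Fin d → Fin d → ℕ} → (∀ i j → a i j ≡ b i j) → mat d a ≋ mat d b

≋-trans : ∀ {A B C} → A ≋ B → B ≋ C → A ≋ C
≋-trans (pointwise p) (pointwise q) = pointwise (λ i j → trans (p i j) (q i j))

firstPos-cong : ∀ {k} {v w : Fin k → ℕ} → (∀ i → v i ≡ w i) → firstPos v ≡ firstPos w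
firstPos-cong {zero}          v≗w = refl
firstPos-cong {suc k} {v} {w} v≗w with v F.zero | w F.zero | v≗w F.zero
... | zero  | .zero    | refl = cong (M.map F.suc) (firstPos-cong (v≗w ∘ F.suc))
... | suc _ | .(suc _) | refl = refl

module _ (m : ℕ) {a b : Fin (suc m) → Fin (suc m) → ℕ} (a≗b : ∀ i j → a i j ≡ b i j) where

  index0-cong : index0 m a ≡ index0 m b
  index0-cong rewrite firstPos-cong (λ r → a≗b r (fromℕ m)) = refl

  otherPos-cong : ∀ i → otherPos m a i ≡ otherPos m b i
  otherPos-cong i rewrite firstPos-cong (λ j → cong (if eqF j (fromℕ m) then 0 else_) (a≗b i j)) = refl

  decr-cong : ∀ i → decr m a i ≋ decr m b i
  decr-cong i = pointwise λ r c →
    cong (λ z → if eqF r i ∧ eqF c (fromℕ m) then z ∸ 1 else z) (a≗b r c)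

  fStep-cong : ∀ i v → fStep m a i v ≋ fStep m b i v
  fStep-cong i zero          = pointwise a≗b
  fStep-cong i (suc (suc _)) = decr-cong i
  fStep-cong i (suc zero) with eqF i (fromℕ m)
  ... | true = pointwise (λ r c → a≗b _ _)
  ... | false rewrite otherPos-cong i with otherPos m b i
  ...   | true  = decr-cong i
  ...   | false = pointwise (λ r c → cong₂ (if _ then_else_) (a≗b _ _) (a≗b _ _))

f-cong : ∀ {A B} → A ≋ B → f A ≋ f B
f-cong (pointwise {zero} a≗b) = pointwise a≗b
f-cong (pointwise {suc m} {a} {b} a≗b) rewrite index0-cong m a≗b | a≗b (index0 m b) (fromℕ m) =
  fStep-cong m a≗b (index0 m b) (b (index0 m b) (fromℕ m))

indexMinus1-cong : ∀ {A B} → A ≋ B → indexMinus1 A ≡ indexMinus1 B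
indexMinus1-cong (pointwise {zero}  _)   = refl
indexMinus1-cong (pointwise {suc m} a≗b) = cong toℕ (index0-cong m a≗b)

Γ-cong : ∀ n {A B} → A ≋ B → Γ n A ≡ Γ n B
Γ-cong zero          _   = refl
Γ-cong (suc zero)    _   = refl
Γ-cong (suc (suc n)) A≋B =
  cong₂ _++_ (Γ-cong (suc n) (f-cong A≋B)) (cong [_] (indexMinus1-cong A≋B))

entrySum-cong : ∀ {A B} → A ≋ B → entrySum A ≡ entrySum B
entrySum-cong (pointwise a≗b) = ∑-cong (λ i → ∑-cong (a≗b i))
  where
  ∑-cong : ∀ {k} {v w : Fin k → ℕ} → (∀ i → v i ≡ w i) → ∑ v ≡ ∑ w
  ∑-cong {zero}  v≗w = refl
  ∑-cong {suc k} v≗w = cong₂ _+_ (v≗w F.zero) (∑-cong (v≗w ∘ F.suc))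

onlyAt : ℕ → ℕ → ℕ → ℕ
onlyAt zero    v zero    = v
onlyAt zero    v (suc j) = 0
onlyAt (suc p) v zero    = 0
onlyAt (suc p) v (suc j) = onlyAt p v j

onlyAt-same : ∀ p v → onlyAt p v p ≡ v
onlyAt-same zero    v = refl
onlyAt-same (suc p) v = onlyAt-same p v

onlyAt-other : ∀ p v j → j ≢ p → onlyAt p v j ≡ 0
onlyAt-other zero    v zero    j≢p = ⊥-elim (j≢p refl)
onlyAt-other zero    v (suc j) j≢p = refl
onlyAt-other (suc p) v zero    j≢p = refl
onlyAt-other (suc p) v (suc j) j≢p = onlyAt-other p v j (j≢p ∘ cong suc)

onlyAt-zero : ∀ p j → onlyAt p 0 j ≡ 0
onlyAt-zero zero    zero    = refl
onlyAt-zero zero    (suc j) = refl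
onlyAt-zero (suc p) zero    = refl
onlyAt-zero (suc p) (suc j) = onlyAt-zero p j

onlyAt-cong : ∀ p j {v w} → (j ≡ p → v ≡ w) → onlyAt p v j ≡ onlyAt p w j
onlyAt-cong zero    zero    v≡w = v≡w refl
onlyAt-cong zero    (suc j) v≡w = refl
onlyAt-cong (suc p) zero    v≡w = refl
onlyAt-cong (suc p) (suc j) v≡w = onlyAt-cong p j (v≡w ∘ cong suc)

bandEntry : (ℕ → ℕ) → (ℕ → ℕ) → ℕ → ℕ → ℕ
bandEntry D S r c = onlyAt r (D r) c + onlyAt (suc r) (S r) c

module _ (D S : ℕ → ℕ) where

  bandEntry-diag : ∀ r → bandEntry D S r r ≡ D r
  bandEntry-diag r rewrite onlyAt-same r (D r) | onlyAt-other (suc r) (S r) r (NP.1+n≢n ∘ sym) =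
    NP.+-identityʳ (D r)

  bandEntry-super : ∀ r → bandEntry D S r (suc r) ≡ S r
  bandEntry-super r rewrite onlyAt-same (suc r) (S r) | onlyAt-other r (D r) (suc r) NP.1+n≢n = refl

  bandEntry-cong : ∀ D′ S′ r c → (c ≡ r → D r ≡ D′ r) → (c ≡ suc r → S r ≡ S′ r) →
                   bandEntry D S r c ≡ bandEntry D′ S′ r c
  bandEntry-cong D′ S′ r c diag super = cong₂ _+_ (onlyAt-cong r c diag) (onlyAt-cong (suc r) c super)

  bandEntry-zero : ∀ r c → (c ≡ r → D r ≡ 0) → (c ≡ suc r → S r ≡ 0) → bandEntry D S r c ≡ 0
  bandEntry-zero r c diag super =
    trans (bandEntry-cong (λ _ → 0) (λ _ → 0) r c diag super)
          (cong₂ _+_ (onlyAt-zero r c) (onlyAt-zero (suc r) c))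

  bandEntry-off : ∀ r c → c ≢ r → c ≢ suc r → bandEntry D S r c ≡ 0
  bandEntry-off r c c≢r c≢1+r = bandEntry-zero r c (⊥-elim ∘ c≢r) (⊥-elim ∘ c≢1+r)

bandEntries : (ℕ → ℕ) → (ℕ → ℕ) → ∀ {d} → Fin d → Fin d → ℕ
bandEntries D S i j = bandEntry D S (toℕ i) (toℕ j)

bandMat : ℕ → (ℕ → ℕ) → (ℕ → ℕ) → Mat
bandMat m D S = mat (suc m) (bandEntries D S)

bandMat-cong : ∀ m {D S D′ S′} →
               (∀ k → k ≤ m → D k ≡ D′ k) → (∀ k → k < m → S k ≡ S′ k) → bandMat m D S ≋ bandMat m D′ S′
bandMat-cong m {D} {S} {D′} {S′} D≗D′ S≗S′ = pointwise λ i j →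
  bandEntry-cong D S D′ S′ (toℕ i) (toℕ j)
    (λ _ → D≗D′ (toℕ i) (FP.toℕ≤pred[n] i))
    (λ j≡1+i → S≗S′ (toℕ i) (subst (_≤ m) j≡1+i (FP.toℕ≤pred[n] j)))

bandMat-bidiagonal : ∀ m D S → Bidiagonal (bandMat m D S)
bandMat-bidiagonal m D S i j = bandEntry-off D S (toℕ i) (toℕ j)

diagonalOf superdiagonalOf : (ℕ → ℕ → ℕ) → ℕ → ℕ
diagonalOf      E k = E k k
superdiagonalOf E k = E k (suc k)

bandEntry-reconstruct : ∀ (E : ℕ → ℕ → ℕ) r c → (c ≢ r → c ≢ suc r → E r c ≡ 0) →
                        E r c ≡ bandEntry (diagonalOf E) (superdiagonalOf E) r c
bandEntry-reconstruct E r c off with c ≟ r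
... | yes refl = sym (bandEntry-diag (diagonalOf E) (superdiagonalOf E) r)
... | no c≢r with c ≟ suc r
...   | yes refl  = sym (bandEntry-super (diagonalOf E) (superdiagonalOf E) r)
...   | no c≢1+r =
        trans (off c≢r c≢1+r) (sym (bandEntry-off (diagonalOf E) (superdiagonalOf E) r c c≢r c≢1+r))

extendEntries : ∀ {m} → (Fin (suc m) → Fin (suc m) → ℕ) → ℕ → ℕ → ℕ
extendEntries {m} a r c with r <? suc m | c <? suc m
... | yes r<1+m | yes c<1+m = a (fromℕ< r<1+m) (fromℕ< c<1+m)
... | _         | _         = 0

extendEntries-toℕ : ∀ {m} a (i j : Fin (suc m)) → extendEntries a (toℕ i) (toℕ j) ≡ a i j
extendEntries-toℕ {m} a i j with toℕ i <? suc m | toℕ j <? suc m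
... | yes i<1+m | yes j<1+m = cong₂ a (FP.fromℕ<-toℕ i i<1+m) (FP.fromℕ<-toℕ j j<1+m)
... | no i≮1+m  | _         = ⊥-elim (i≮1+m (FP.toℕ<n i))
... | yes _     | no j≮1+m  = ⊥-elim (j≮1+m (FP.toℕ<n j))

sumBelow : ℕ → (ℕ → ℕ) → ℕ
sumBelow zero    g = 0
sumBelow (suc k) g = sumBelow k g + g k

sumBelow-cong : ∀ k {g h} → (∀ i → i < k → g i ≡ h i) → sumBelow k g ≡ sumBelow k h
sumBelow-cong zero    g≗h = refl
sumBelow-cong (suc k) g≗h =
  cong₂ _+_ (sumBelow-cong k (λ i i<k → g≗h i (NP.m≤n⇒m≤1+n i<k))) (g≗h k NP.≤-refl)

sumBelow-suc : ∀ k g → sumBelow (suc k) g ≡ g 0 + sumBelow k (g ∘ suc)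
sumBelow-suc zero    g = NP.+-comm 0 (g 0)
sumBelow-suc (suc k) g = trans (cong (_+ g (suc k)) (sumBelow-suc k g)) (NP.+-assoc (g 0) _ _)

sumBelow-+ : ∀ k g h → sumBelow k (λ i → g i + h i) ≡ sumBelow k g + sumBelow k h
sumBelow-+ zero    g h = refl
sumBelow-+ (suc k) g h rewrite sumBelow-+ k g h =
  interchange (sumBelow k g) (sumBelow k h) (g k) (h k)
  where
  interchange : ∀ a b c d → a + b + (c + d) ≡ a + c + (b + d)
  interchange = solve-∀

sumBelow-onlyAt-≥ : ∀ k p v → k ≤ p → sumBelow k (onlyAt p v) ≡ 0
sumBelow-onlyAt-≥ zero    p v _   = refl
sumBelow-onlyAt-≥ (suc k) p v k<p =
  cong₂ _+_ (sumBelow-onlyAt-≥ k p v (NP.<⇒≤ k<p)) (onlyAt-other p v k (NP.<⇒≢ k<p))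

sumBelow-onlyAt-< : ∀ k p v → p < k → sumBelow k (onlyAt p v) ≡ v
sumBelow-onlyAt-< (suc k) p v p<1+k with p ≟ k
... | yes refl = cong₂ _+_ (sumBelow-onlyAt-≥ k p v NP.≤-refl) (onlyAt-same p v)
... | no p≢k   =
      trans (cong₂ _+_ (sumBelow-onlyAt-< k p v (NP.≤∧≢⇒< (NP.≤-pred p<1+k) p≢k))
                       (onlyAt-other p v k (p≢k ∘ sym)))
            (NP.+-identityʳ v)

∑-toℕ : ∀ k g → ∑ {k} (g ∘ toℕ) ≡ sumBelow k g
∑-toℕ zero    g = refl
∑-toℕ (suc k) g = trans (cong (g 0 +_) (∑-toℕ k (g ∘ suc))) (sym (sumBelow-suc k g))

bandWeight : ℕ → (ℕ → ℕ) → (ℕ → ℕ) → ℕ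
bandWeight m D S = sumBelow (suc m) D + sumBelow m S

entrySum-bandMat : ∀ m D S → entrySum (bandMat m D S) ≡ bandWeight m D S
entrySum-bandMat m D S = begin
  entrySum (bandMat m D S)                        ≡⟨ ∑-toℕ (suc m) rowSum ⟩
  sumBelow (suc m) rowSum                         ≡⟨ sumBelow-cong (suc m) rowSum-split ⟩
  sumBelow (suc m) (λ r → D r + superSum r)       ≡⟨ sumBelow-+ (suc m) D superSum ⟩
  sumBelow (suc m) D + sumBelow (suc m) superSum  ≡⟨ cong (sumBelow (suc m) D +_) superSums ⟩
  sumBelow (suc m) D + sumBelow m S               ∎
  where
  open ≡-Reasoning
  rowSum superSum : ℕ → ℕ
  rowSum   r = ∑ {suc m} (λ j → bandEntry D S r (toℕ j))
  superSum r = sumBelow (suc m) (onlyAt (suc r) (S r))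
  rowSum-split : ∀ r → r < suc m → rowSum r ≡ D r + superSum r
  rowSum-split r r<1+m = begin
    rowSum r                                        ≡⟨ ∑-toℕ (suc m) (bandEntry D S r) ⟩
    sumBelow (suc m) (bandEntry D S r)              ≡⟨ sumBelow-+ (suc m) _ _ ⟩
    sumBelow (suc m) (onlyAt r (D r)) + superSum r
      ≡⟨ cong (_+ superSum r) (sumBelow-onlyAt-< (suc m) r (D r) r<1+m) ⟩
    D r + superSum r                                ∎
  superSums : sumBelow (suc m) superSum ≡ sumBelow m S
  superSums =
    trans (cong₂ _+_ (sumBelow-cong m (λ r r<m → sumBelow-onlyAt-< (suc m) (suc r) (S r) (s≤s r<m)))
                     (sumBelow-onlyAt-≥ (suc m) (suc m) (S m) NP.≤-refl))
          (NP.+-identityʳ _)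

record NonzeroExceptLastRow (m : ℕ) (D S : ℕ → ℕ) : Set where
  field
    firstColumn : 0 < D 0
    row         : ∀ k → k < m → 0 < D k + S k
    column      : ∀ k → k < m → 0 < D (suc k) + S k

atPosition : ∀ {m} (P : ℕ → Set) → (∀ (j : Fin (suc m)) → P (toℕ j)) → ∀ c → c ≤ m → P c
atPosition P h c c≤m = subst P (FP.toℕ-fromℕ< (s≤s c≤m)) (h (fromℕ< (s≤s c≤m)))

positive-sum-⊥ : ∀ {a b} → 0 < a + b → a ≡ 0 → b ≡ 0 → ⊥
positive-sum-⊥ 0<a+b refl refl = NP.<-irrefl refl 0<a+b

module _ (m : ℕ) (D S : ℕ → ℕ) where

  ZeroRow ZeroColumn : ℕ → Set
  ZeroRow    r = ∀ c → c ≤ m → bandEntry D S r c ≡ 0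
  ZeroColumn c = ∀ r → r ≤ m → bandEntry D S r c ≡ 0

  bandMat-InInt : NonzeroExceptLastRow m D S → 0 < D m → InInt (bandWeight m D S) (bandMat m D S)
  bandMat-InInt nz 0<Dₘ =
      (λ i j j<i → bandEntry-off D S (toℕ i) (toℕ j) (NP.<⇒≢ j<i) (NP.<⇒≢ (NP.m<n⇒m<1+n j<i)))
    , entrySum-bandMat m D S
    , (λ i rowZero → row-nonzero (toℕ i) (FP.toℕ≤pred[n] i)
                       (atPosition (λ c → bandEntry D S (toℕ i) c ≡ 0) rowZero))
    , (λ j columnZero → column-nonzero (toℕ j) (FP.toℕ≤pred[n] j)
                          (atPosition (λ r → bandEntry D S r (toℕ j) ≡ 0) columnZero))
    where
    open NonzeroExceptLastRow nz
    diagonal-zero : ∀ {r} → ZeroRow r → r ≤ m → D r ≡ 0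
    diagonal-zero rowZero r≤m = trans (sym (bandEntry-diag D S _)) (rowZero _ r≤m)
    row-nonzero : ∀ r → r ≤ m → ¬ ZeroRow r
    row-nonzero r r≤m rowZero with NP.m≤n⇒m<n∨m≡n r≤m
    ... | inj₁ r<m  = positive-sum-⊥ (row r r<m) (diagonal-zero rowZero r≤m)
                        (trans (sym (bandEntry-super D S r)) (rowZero (suc r) r<m))
    ... | inj₂ refl = NP.<-irrefl (sym (diagonal-zero rowZero r≤m)) 0<Dₘ
    column-nonzero : ∀ c → c ≤ m → ¬ ZeroColumn c
    column-nonzero zero    _     columnZero =
      NP.<-irrefl (sym (trans (sym (bandEntry-diag D S 0)) (columnZero 0 z≤n))) firstColumn
    column-nonzero (suc k) 1+k≤m columnZero = positive-sum-⊥ (column k 1+k≤m)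
      (trans (sym (bandEntry-diag D S (suc k))) (columnZero (suc k) 1+k≤m))
      (trans (sym (bandEntry-super D S k)) (columnZero k (NP.<⇒≤ 1+k≤m)))

bidiagonal⇒bandMat : ∀ {n} A → 1 ≤ n → InInt n A → Bidiagonal A →
  ∃ λ m → ∃ λ D → ∃ λ S → A ≋ bandMat m D S × NonzeroExceptLastRow m D S × 0 < D m
bidiagonal⇒bandMat (mat zero a) 1≤n (_ , sum≡n , _) _ = ⊥-elim (NP.<-irrefl sum≡n 1≤n)
bidiagonal⇒bandMat (mat (suc m) a) _ (_ , _ , rows , columns) bidiag =
  m , D , S , pointwise entries , nz , NP.n≢0⇒n>0 (row-nonzero m NP.≤-refl ∘ lastRow-zero)
  where
  E = extendEntries a
  D = diagonalOf E
  S = superdiagonalOf E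
  entries : ∀ i j → a i j ≡ bandEntries D S i j
  entries i j = trans (sym (extendEntries-toℕ a i j)) (bandEntry-reconstruct E (toℕ i) (toℕ j)
    (λ j≢i j≢1+i → trans (extendEntries-toℕ a i j) (bidiag i j j≢i j≢1+i)))
  row-nonzero : ∀ r → r ≤ m → ¬ ZeroRow m D S r
  row-nonzero = atPosition (λ r → ¬ ZeroRow m D S r) λ i rowZero →
    rows i λ j → trans (entries i j) (rowZero (toℕ j) (FP.toℕ≤pred[n] j))
  column-nonzero : ∀ c → c ≤ m → ¬ ZeroColumn m D S c
  column-nonzero = atPosition (λ c → ¬ ZeroColumn m D S c) λ j columnZero →
    columns j λ i → trans (entries i j) (columnZero (toℕ i) (FP.toℕ≤pred[n] i))
  lastRow-zero : D m ≡ 0 → ZeroRow m D S m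
  lastRow-zero Dₘ≡0 c c≤m =
    bandEntry-zero D S m c (λ _ → Dₘ≡0) (λ c≡1+m → ⊥-elim (NP.1+n≰n (subst (_≤ m) c≡1+m c≤m)))
  nz : NonzeroExceptLastRow m D S
  nz = record
    { firstColumn = NP.n≢0⇒n>0 λ D₀≡0 → column-nonzero 0 z≤n λ r _ →
        bandEntry-zero D S r 0 (λ 0≡r → subst (λ k → D k ≡ 0) 0≡r D₀≡0) (λ ())
    ; row = λ k k<m → NP.n≢0⇒n>0 λ sum≡0 → row-nonzero k (NP.<⇒≤ k<m) λ c _ →
        bandEntry-zero D S k c (λ _ → NP.m+n≡0⇒m≡0 _ sum≡0) (λ _ → NP.m+n≡0⇒n≡0 _ sum≡0)
    ; column = λ k k<m → NP.n≢0⇒n>0 λ sum≡0 → column-nonzero (suc k) k<m λ r _ →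
        bandEntry-zero D S r (suc k)
          (λ 1+k≡r → subst (λ i → D i ≡ 0) 1+k≡r (NP.m+n≡0⇒m≡0 _ sum≡0))
          (λ 1+k≡1+r → subst (λ i → S i ≡ 0) (NP.suc-injective 1+k≡1+r) (NP.m+n≡0⇒n≡0 _ sum≡0))
    }

update : (ℕ → ℕ) → ℕ → ℕ → ℕ → ℕ
update g p v k = if does (k ≟ p) then v else g k

update-same : ∀ g p v → update g p v p ≡ v
update-same g p v = cong (λ b → if b then v else g p) (dec-true (p ≟ p) refl)

update-other : ∀ g p v k → k ≢ p → update g p v k ≡ g k
update-other g p v k k≢p = cong (λ b → if b then v else g k) (dec-false (k ≟ p) k≢p)

update-< : ∀ g p v k → k < p → update g p v k ≡ g k
update-< g p v k k<p = update-other g p v k (NP.<⇒≢ k<p)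

update-update : ∀ g p v w k → update (update g p v) p w k ≡ update g p w k
update-update g p v w k with k ≟ p
... | yes refl = trans (update-same (update g k v) k w) (sym (update-same g k w))
... | no k≢p   = trans (update-other (update g p v) p w k k≢p)
                       (trans (update-other g p v k k≢p) (sym (update-other g p w k k≢p)))

firstPos-just : ∀ {k} (v : Fin k → ℕ) i → (∀ j → toℕ j < toℕ i → v j ≡ 0) → 0 < v i →
                firstPos v ≡ just i
firstPos-just v F.zero _ 0<v₀ with v F.zero | 0<v₀
... | suc _ | _ = refl
firstPos-just v (F.suc i) before 0<vᵢ with v F.zero | before F.zero (s≤s z≤n)
... | .zero | refl =
      cong (M.map F.suc) (firstPos-just (v ∘ F.suc) i (λ j → before (F.suc j) ∘ s≤s) 0<vᵢ)

firstPos-allZero : ∀ {k} (v : Fin k → ℕ) → (∀ j → v j ≡ 0) → firstPos v ≡ nothing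
firstPos-allZero {zero}  v _       = refl
firstPos-allZero {suc k} v allZero with v F.zero | allZero F.zero
... | .zero | refl = cong (M.map F.suc) (firstPos-allZero (v ∘ F.suc) (allZero ∘ F.suc))

firstPos-positive : ∀ {k} (v : Fin k → ℕ) j → 0 < v j → ∃ λ i → firstPos v ≡ just i
firstPos-positive {suc k} v j 0<vⱼ with v F.zero in v₀≡
... | suc _ = F.zero , refl
firstPos-positive v F.zero    0<v₀ | zero = ⊥-elim (NP.<-irrefl (sym v₀≡) 0<v₀)
firstPos-positive v (F.suc j) 0<vⱼ | zero with firstPos-positive (v ∘ F.suc) j 0<vⱼ
... | i , firstPos≡ = F.suc i , cong (M.map F.suc) firstPos≡

module _ (m : ℕ) (a : Fin (suc m) → Fin (suc m) → ℕ) (i : Fin (suc m)) where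

  offLast : Fin (suc m) → ℕ
  offLast j = if eqF j (fromℕ m) then 0 else a i j

  otherPos-positive : ∀ j → 0 < offLast j → otherPos m a i ≡ true
  otherPos-positive j 0<entry with firstPos offLast | firstPos-positive offLast j 0<entry
  ... | just _  | _      = refl
  ... | nothing | _ , ()

  otherPos-allZero : (∀ j → offLast j ≡ 0) → otherPos m a i ≡ false
  otherPos-allZero allZero rewrite firstPos-allZero offLast allZero = refl

penultimate : ∀ q → Fin (suc (suc q))
penultimate q = inject₁ (fromℕ q)

toℕ-penultimate : ∀ q → toℕ (penultimate q) ≡ q
toℕ-penultimate q = trans (FP.toℕ-inject₁ (fromℕ q)) (FP.toℕ-fromℕ q)

≢last⇒toℕ≢ : ∀ {m} {r : Fin (suc m)} → r ≢ fromℕ m → toℕ r ≢ m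
≢last⇒toℕ≢ {m} r≢last r≡m = r≢last (FP.toℕ-injective (trans r≡m (sym (FP.toℕ-fromℕ m))))

eqF-last : ∀ {m} (x : Fin (suc m)) → toℕ x ≡ m → eqF x (fromℕ m) ≡ true
eqF-last {m} x x≡m = dec-true (x F.≟ fromℕ m) (FP.toℕ-injective (trans x≡m (sym (FP.toℕ-fromℕ m))))

eqF-notLast : ∀ {m} (x : Fin (suc m)) → toℕ x ≢ m → eqF x (fromℕ m) ≡ false
eqF-notLast {m} x x≢m =
  dec-false (x F.≟ fromℕ m) λ x≡last → x≢m (trans (cong toℕ x≡last) (FP.toℕ-fromℕ m))

eqF-penultimate-last : ∀ q → eqF (penultimate q) (fromℕ (suc q)) ≡ false
eqF-penultimate-last q =
  eqF-notLast (penultimate q) λ q≡1+q → NP.1+n≢n (trans (sym q≡1+q) (toℕ-penultimate q))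

if-cong : ∀ {b b′ : Bool} {x y : ℕ} → b ≡ b′ → (if b then x else y) ≡ (if b′ then x else y)
if-cong refl = refl

diagonalCorner : ∀ D S m → bandEntries D S (fromℕ m) (fromℕ m) ≡ D m
diagonalCorner D S m =
  trans (cong₂ (bandEntry D S) (FP.toℕ-fromℕ m) (FP.toℕ-fromℕ m)) (bandEntry-diag D S m)

superCorner : ∀ D S q → bandEntries D S (penultimate q) (fromℕ (suc q)) ≡ S q
superCorner D S q =
  trans (cong₂ (bandEntry D S) (toℕ-penultimate q) (FP.toℕ-fromℕ (suc q))) (bandEntry-super D S q)

module _ (D S : ℕ → ℕ) where

  lastColumn : ∀ m (r : Fin (suc m)) → bandEntries D S r (fromℕ m) ≡ bandEntry D S (toℕ r) m
  lastColumn m r = cong (bandEntry D S (toℕ r)) (FP.toℕ-fromℕ m)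

  index0-bandMat : ∀ m (i : Fin (suc m)) p → toℕ i ≡ p → (∀ r → r < p → bandEntry D S r m ≡ 0) →
                   0 < bandEntry D S p m → index0 m (bandEntries D S) ≡ i
  index0-bandMat m i p refl above 0<entry
    rewrite firstPos-just (λ r → bandEntries D S r (fromℕ m)) i
              (λ j j<i → trans (lastColumn m j) (above (toℕ j) j<i))
              (subst (0 <_) (sym (lastColumn m i)) 0<entry) = refl

  index0-super : ∀ q → 0 < S q → index0 (suc q) (bandEntries D S) ≡ penultimate q
  index0-super q 0<Sq = index0-bandMat (suc q) (penultimate q) q (toℕ-penultimate q)
    (λ r r<q → bandEntry-zero D S r (suc q)
      (λ 1+q≡r → ⊥-elim (NP.<⇒≱ r<q (NP.≤-trans (NP.n≤1+n q) (NP.≤-reflexive 1+q≡r))))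
      (λ 1+q≡1+r → ⊥-elim (NP.<⇒≢ r<q (sym (NP.suc-injective 1+q≡1+r)))))
    (subst (0 <_) (sym (bandEntry-super D S q)) 0<Sq)

  index0-diag : ∀ m → S (pred m) ≡ 0 → 0 < D m → index0 m (bandEntries D S) ≡ fromℕ m
  index0-diag m S≡0 0<Dm = index0-bandMat m (fromℕ m) m (FP.toℕ-fromℕ m)
    (λ r r<m → bandEntry-zero D S r m (λ m≡r → ⊥-elim (NP.<⇒≢ r<m (sym m≡r)))
                                      (λ m≡1+r → subst (λ k → S k ≡ 0) (cong pred m≡1+r) S≡0))
    (subst (0 <_) (sym (bandEntry-diag D S m)) 0<Dm)

  decr-diag : ∀ m v → D m ≡ suc v → decr m (bandEntries D S) (fromℕ m) ≋ bandMat m (update D m v) S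
  decr-diag m v Dm≡1+v = pointwise entry
    where
    entry : ∀ r c → (if eqF r (fromℕ m) ∧ eqF c (fromℕ m) then bandEntries D S r c ∸ 1
                     else bandEntries D S r c)
                    ≡ bandEntries (update D m v) S r c
    entry r c with r F.≟ fromℕ m | c F.≟ fromℕ m
    ... | yes refl | yes refl =
          trans (cong (_∸ 1) (trans (diagonalCorner D S m) Dm≡1+v))
                (sym (trans (diagonalCorner (update D m v) S m) (update-same D m v)))
    ... | yes refl | no c≢last = bandEntry-cong D S (update D m v) S (toℕ r) (toℕ c)
          (λ c≡r → ⊥-elim (c≢last (FP.toℕ-injective c≡r))) (λ _ → refl)
    ... | no r≢last | _ = bandEntry-cong D S (update D m v) S (toℕ r) (toℕ c)
          (λ _ → sym (update-other D m v (toℕ r) (≢last⇒toℕ≢ r≢last))) (λ _ → refl)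

  decr-super : ∀ q v → S q ≡ suc v →
               decr (suc q) (bandEntries D S) (penultimate q) ≋ bandMat (suc q) D (update S q v)
  decr-super q v Sq≡1+v = pointwise entry
    where
    pen = penultimate q
    entry : ∀ r c → (if eqF r pen ∧ eqF c (fromℕ (suc q)) then bandEntries D S r c ∸ 1
                     else bandEntries D S r c)
                    ≡ bandEntries D (update S q v) r c
    entry r c with r F.≟ pen | c F.≟ fromℕ (suc q)
    ... | yes refl | yes refl =
          trans (cong (_∸ 1) (trans (superCorner D S q) Sq≡1+v))
                (sym (trans (superCorner D (update S q v) q) (update-same S q v)))
    ... | yes refl | no c≢last = bandEntry-cong D S D (update S q v) (toℕ r) (toℕ c) (λ _ → refl)
          (λ c≡1+r → ⊥-elim (≢last⇒toℕ≢ c≢last (trans c≡1+r (cong suc (toℕ-penultimate q)))))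
    ... | no r≢pen | _ = bandEntry-cong D S D (update S q v) (toℕ r) (toℕ c) (λ _ → refl)
          (λ _ → sym (update-other S q v (toℕ r) λ r≡q →
                        r≢pen (FP.toℕ-injective (trans r≡q (sym (toℕ-penultimate q))))))

  delLast-bandMat : ∀ q → delLast (suc q) (bandEntries D S) ≋ bandMat q D S
  delLast-bandMat q = pointwise λ r c → cong₂ (bandEntry D S) (FP.toℕ-inject₁ r) (FP.toℕ-inject₁ c)

data PunchView (q : ℕ) (x : Fin (suc q)) : Set where
  below : toℕ x < q → toℕ (punchIn (penultimate q) x) ≡ toℕ x → PunchView q x
  at    : toℕ x ≡ q → toℕ (punchIn (penultimate q) x) ≡ suc q → PunchView q x

punchView : ∀ q x → PunchView q x
punchView zero    F.zero    = at refl refl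
punchView (suc q) F.zero    = below (s≤s z≤n) refl
punchView (suc q) (F.suc x) with punchView q x
... | below x<q x↦x = below (s≤s x<q) (cong suc x↦x)
... | at x≡q x↦1+q  = at (cong suc x≡q) (cong suc x↦1+q)

rem3-bandMat : ∀ q D S → rem3 (suc q) (bandEntries D S) (penultimate q) ≋ bandMat q (update D q (D (suc q))) S
rem3-bandMat q D S = pointwise entry
  where
  i = penultimate q
  D′ = update D q (D (suc q))
  notLast : ∀ {c} → toℕ c < q → toℕ (punchIn i c) ≡ toℕ c →
            eqF (punchIn i c) (fromℕ (suc q)) ≡ false
  notLast c<q c↦c = eqF-notLast _ λ c′≡1+q → NP.<⇒≢ (NP.m<n⇒m<1+n c<q) (trans (sym c↦c) c′≡1+q)
  entry : ∀ r c → (if eqF (punchIn i c) (fromℕ (suc q)) ∧ does (toℕ (punchIn i r) <? toℕ i)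
                   then bandEntries D S (punchIn i r) i else bandEntries D S (punchIn i r) (punchIn i c))
                  ≡ bandEntries D′ S r c
  entry r c with punchView q r | punchView q c
  ... | below r<q r↦r | below c<q c↦c rewrite r↦r | c↦c | toℕ-penultimate q =
        trans (if-cong (cong (_∧ _) (notLast c<q c↦c)))
              (bandEntry-cong D S D′ S (toℕ r) (toℕ c)
                              (λ _ → sym (update-< D q _ (toℕ r) r<q)) (λ _ → refl))
  ... | at r≡q r↦1+q | below c<q c↦c rewrite r↦1+q | c↦c | toℕ-penultimate q | r≡q =
        trans (if-cong (cong (_∧ _) (notLast c<q c↦c)))
              (trans (bandEntry-off D S (suc q) (toℕ c) (NP.<⇒≢ (NP.m<n⇒m<1+n c<q))
                                    (NP.<⇒≢ (NP.m<n⇒m<1+n (NP.m<n⇒m<1+n c<q))))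
                     (sym (bandEntry-off D′ S q (toℕ c) (NP.<⇒≢ c<q) (NP.<⇒≢ (NP.m<n⇒m<1+n c<q)))))
  ... | below r<q r↦r | at c≡q c↦1+q rewrite r↦r | c↦1+q | toℕ-penultimate q | c≡q =
        trans (if-cong (cong₂ _∧_ (eqF-last (punchIn i c) c↦1+q) (dec-true (toℕ r <? q) r<q)))
              (bandEntry-cong D S D′ S (toℕ r) q
                              (λ q≡r → ⊥-elim (NP.<⇒≢ r<q (sym q≡r))) (λ _ → refl))
  ... | at r≡q r↦1+q | at c≡q c↦1+q rewrite r↦1+q | c↦1+q | toℕ-penultimate q | r≡q | c≡q =
        trans (if-cong (cong₂ _∧_ (eqF-last (punchIn i c) c↦1+q)
                                  (dec-false (suc q <? q) (NP.<-asym (NP.n<1+n q)))))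
              (trans (bandEntry-diag D S (suc q)) (sym (trans (bandEntry-diag D′ S q) (update-same D q _))))

f-bandMat-step : ∀ {M} m D S i v → index0 m (bandEntries D S) ≡ i → bandEntries D S i (fromℕ m) ≡ v →
                 fStep m (bandEntries D S) i v ≋ M → f (bandMat m D S) ≋ M
f-bandMat-step m D S i v refl refl step = step

module _ (D S : ℕ → ℕ) where

  f-bandMat-diag : ∀ {M} m v → S (pred m) ≡ 0 → D m ≡ suc v →
                   fStep m (bandEntries D S) (fromℕ m) (suc v) ≋ M → f (bandMat m D S) ≋ M
  f-bandMat-diag m v S≡0 Dm≡ = f-bandMat-step m D S (fromℕ m) (suc v)
    (index0-diag D S m S≡0 (subst (0 <_) (sym Dm≡) (s≤s z≤n))) (trans (diagonalCorner D S m) Dm≡)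

  f-bandMat-super : ∀ {M} q v → S q ≡ suc v →
                    fStep (suc q) (bandEntries D S) (penultimate q) (suc v) ≋ M → f (bandMat (suc q) D S) ≋ M
  f-bandMat-super q v Sq≡ = f-bandMat-step (suc q) D S (penultimate q) (suc v)
    (index0-super D S q (subst (0 <_) (sym Sq≡) (s≤s z≤n))) (trans (superCorner D S q) Sq≡)

  f-bandMat-decrDiag : ∀ m v → S (pred m) ≡ 0 → D m ≡ suc (suc v) →
                       f (bandMat m D S) ≋ bandMat m (update D m (suc v)) S
  f-bandMat-decrDiag m v S≡0 Dm≡ = f-bandMat-diag m (suc v) S≡0 Dm≡ (decr-diag D S m (suc v) Dm≡)

  f-bandMat-dropLast : ∀ q → S q ≡ 0 → D (suc q) ≡ 1 → f (bandMat (suc q) D S) ≋ bandMat q D S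
  f-bandMat-dropLast q Sq≡0 D₁₊q≡1 = f-bandMat-diag (suc q) 0 Sq≡0 D₁₊q≡1 step
    where
    step : fStep (suc q) (bandEntries D S) (fromℕ (suc q)) 1 ≋ bandMat q D S
    step rewrite dec-true (fromℕ (suc q) F.≟ fromℕ (suc q)) refl = delLast-bandMat D S q

  f-bandMat-decrSuper : ∀ q v → S q ≡ suc (suc v) →
                        f (bandMat (suc q) D S) ≋ bandMat (suc q) D (update S q (suc v))
  f-bandMat-decrSuper q v Sq≡ = f-bandMat-super q (suc v) Sq≡ (decr-super D S q (suc v) Sq≡)

  f-bandMat-clearSuper : ∀ q → S q ≡ 1 → 0 < D q →
                         f (bandMat (suc q) D S) ≋ bandMat (suc q) D (update S q 0)
  f-bandMat-clearSuper q Sq≡1 0<Dq = f-bandMat-super q 0 Sq≡1 step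
    where
    pen = penultimate q
    diagonalEntry : offLast (suc q) (bandEntries D S) pen pen ≡ D q
    diagonalEntry = trans (if-cong (eqF-penultimate-last q))
      (trans (cong₂ (bandEntry D S) (toℕ-penultimate q) (toℕ-penultimate q)) (bandEntry-diag D S q))
    step : fStep (suc q) (bandEntries D S) pen 1 ≋ bandMat (suc q) D (update S q 0)
    step rewrite eqF-penultimate-last q
               | otherPos-positive (suc q) (bandEntries D S) pen pen (subst (0 <_) (sym diagonalEntry) 0<Dq)
      = decr-super D S q 0 Sq≡1

  f-bandMat-merge : ∀ q → S q ≡ 1 → D q ≡ 0 →
                    f (bandMat (suc q) D S) ≋ bandMat q (update D q (D (suc q))) S
  f-bandMat-merge q Sq≡1 Dq≡0 = f-bandMat-super q 0 Sq≡1 step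
    where
    pen = penultimate q
    rowZero : ∀ j → offLast (suc q) (bandEntries D S) pen j ≡ 0
    rowZero j with j F.≟ fromℕ (suc q)
    ... | yes _     = refl
    ... | no j≢last = subst (λ r → bandEntry D S r (toℕ j) ≡ 0) (sym (toℕ-penultimate q))
                        (bandEntry-zero D S q (toℕ j) (λ _ → Dq≡0) (⊥-elim ∘ ≢last⇒toℕ≢ j≢last))
    step : fStep (suc q) (bandEntries D S) pen 1 ≋ bandMat q (update D q (D (suc q))) S
    step rewrite eqF-penultimate-last q | otherPos-allZero (suc q) (bandEntries D S) pen rowZero = rem3-bandMat q D S

infixl 5 _⟨_∣_⟩

-- first d is the 1×1 matrix (d); B ⟨ s ∣ d ⟩ appends to B a column whose superdiagonal
-- entry is s and whose diagonal entry is d.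
data Band : Set where
  first  : ℕ → Band
  _⟨_∣_⟩ : Band → ℕ → ℕ → Band

size : Band → ℕ
size (first _)     = 0
size (B ⟨ _ ∣ _ ⟩) = suc (size B)

diagonal superdiagonal : Band → ℕ → ℕ
diagonal      (first d)     = λ _ → d
diagonal      (B ⟨ s ∣ d ⟩) = update (diagonal B) (suc (size B)) d
superdiagonal (first d)     = λ _ → 0
superdiagonal (B ⟨ s ∣ d ⟩) = update (superdiagonal B) (size B) s

toMat : Band → Mat
toMat B = bandMat (size B) (diagonal B) (superdiagonal B)

weight : Band → ℕ
weight (first d)     = d
weight (B ⟨ s ∣ d ⟩) = weight B + s + d

lastDiag : Band → ℕ
lastDiag (first d)     = d
lastDiag (_ ⟨ _ ∣ d ⟩) = d

-- Every column of toMat B, and every row but the last, has a positive entry.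
Inner : Band → Set
Inner (first d)     = 0 < d
Inner (B ⟨ s ∣ d ⟩) = Inner B × 0 < lastDiag B + s × 0 < d + s

Proper : Band → Set
Proper B = Inner B × 0 < lastDiag B

0<+ʳ : ∀ {a} b → 0 < a → 0 < a + b
0<+ʳ {a} b 0<a = NP.<-≤-trans 0<a (NP.m≤m+n a b)

0<+ˡ : ∀ a {b} → 0 < b → 0 < a + b
0<+ˡ a {b} 0<b = NP.<-≤-trans 0<b (NP.m≤n+m b a)

inner⇒0<weight : ∀ B → Inner B → 0 < weight B
inner⇒0<weight (first d)     0<d              = 0<d
inner⇒0<weight (B ⟨ s ∣ d ⟩) (innerB , _ , _) = 0<+ʳ d (0<+ʳ s (inner⇒0<weight B innerB))

diagonal-size : ∀ B → diagonal B (size B) ≡ lastDiag B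
diagonal-size (first d)     = refl
diagonal-size (B ⟨ s ∣ d ⟩) = update-same (diagonal B) (suc (size B)) d

diagonal-penultimate : ∀ B s d → diagonal (B ⟨ s ∣ d ⟩) (size B) ≡ lastDiag B
diagonal-penultimate B s d = trans (update-< (diagonal B) (suc (size B)) d (size B) NP.≤-refl) (diagonal-size B)

inner-nonzero : ∀ B → Inner B → NonzeroExceptLastRow (size B) (diagonal B) (superdiagonal B)
inner-nonzero (first d) 0<d = record { firstColumn = 0<d ; row = λ _ () ; column = λ _ () }
inner-nonzero (B ⟨ s ∣ d ⟩) (innerB , 0<lastRow , 0<lastColumn) = record
  { firstColumn = subst (0 <_) (sym (update-< D (suc m) d 0 (s≤s z≤n))) firstColumn
  ; row         = row′
  ; column      = column′
  }
  where
  m = size B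
  D = diagonal B
  S = superdiagonal B
  open NonzeroExceptLastRow (inner-nonzero B innerB)
  row′ : ∀ k → k < suc m → 0 < update D (suc m) d k + update S m s k
  row′ k k<1+m with NP.m≤n⇒m<n∨m≡n (NP.≤-pred k<1+m)
  ... | inj₁ k<m  = subst₂ (λ a b → 0 < a + b) (sym (update-< D (suc m) d k (NP.m<n⇒m<1+n k<m)))
                                               (sym (update-< S m s k k<m)) (row k k<m)
  ... | inj₂ refl = subst₂ (λ a b → 0 < a + b) (sym (diagonal-penultimate B s d))
                                               (sym (update-same S m s)) 0<lastRow
  column′ : ∀ k → k < suc m → 0 < update D (suc m) d (suc k) + update S m s k
  column′ k k<1+m with NP.m≤n⇒m<n∨m≡n (NP.≤-pred k<1+m)
  ... | inj₁ k<m  = subst₂ (λ a b → 0 < a + b) (sym (update-< D (suc m) d (suc k) (s≤s k<m)))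
                                               (sym (update-< S m s k k<m)) (column k k<m)
  ... | inj₂ refl = subst₂ (λ a b → 0 < a + b) (sym (update-same D (suc m) d))
                                               (sym (update-same S m s)) 0<lastColumn

sumBelow-update-last : ∀ p g v → sumBelow (suc p) (update g p v) ≡ sumBelow p g + v
sumBelow-update-last p g v = cong₂ _+_ (sumBelow-cong p (update-< g p v)) (update-same g p v)

bandWeight-toMat : ∀ B → bandWeight (size B) (diagonal B) (superdiagonal B) ≡ weight B
bandWeight-toMat (first d)     = NP.+-identityʳ (0 + d)
bandWeight-toMat (B ⟨ s ∣ d ⟩) = begin
  sumBelow (suc (suc m)) (update D (suc m) d) + sumBelow (suc m) (update S m s)
    ≡⟨ cong₂ _+_ (sumBelow-update-last (suc m) D d) (sumBelow-update-last m S s) ⟩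
  (sumBelow (suc m) D + d) + (sumBelow m S + s)
    ≡⟨ interchange (sumBelow (suc m) D) d (sumBelow m S) s ⟩
  bandWeight m D S + s + d
    ≡⟨ cong (λ w → w + s + d) (bandWeight-toMat B) ⟩
  weight B + s + d ∎
  where
  open ≡-Reasoning
  m = size B
  D = diagonal B
  S = superdiagonal B
  interchange : ∀ a b c e → a + b + (c + e) ≡ a + c + e + b
  interchange = solve-∀

toMat-InInt : ∀ B → Proper B → InInt (weight B) (toMat B)
toMat-InInt B (innerB , 0<lastDiag) = subst (λ n → InInt n (toMat B)) (bandWeight-toMat B)
  (bandMat-InInt (size B) (diagonal B) (superdiagonal B) (inner-nonzero B innerB)
                 (subst (0 <_) (sym (diagonal-size B)) 0<lastDiag))

fromDiagonals : ℕ → (ℕ → ℕ) → (ℕ → ℕ) → Band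
fromDiagonals zero    D S = first (D 0)
fromDiagonals (suc m) D S = fromDiagonals m D S ⟨ S m ∣ D (suc m) ⟩

module _ (D S : ℕ → ℕ) where

  size-fromDiagonals : ∀ m → size (fromDiagonals m D S) ≡ m
  size-fromDiagonals zero    = refl
  size-fromDiagonals (suc m) = cong suc (size-fromDiagonals m)

  lastDiag-fromDiagonals : ∀ m → lastDiag (fromDiagonals m D S) ≡ D m
  lastDiag-fromDiagonals zero    = refl
  lastDiag-fromDiagonals (suc m) = refl

  diagonal-fromDiagonals : ∀ m k → k ≤ m → diagonal (fromDiagonals m D S) k ≡ D k
  diagonal-fromDiagonals zero    .0 z≤n = refl
  diagonal-fromDiagonals (suc m) k k≤1+m rewrite size-fromDiagonals m with k ≟ suc m
  ... | yes refl = update-same (diagonal (fromDiagonals m D S)) (suc m) (D (suc m))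
  ... | no k≢1+m = trans (update-other (diagonal (fromDiagonals m D S)) (suc m) _ k k≢1+m)
                         (diagonal-fromDiagonals m k (NP.≤-pred (NP.≤∧≢⇒< k≤1+m k≢1+m)))

  superdiagonal-fromDiagonals : ∀ m k → k < m → superdiagonal (fromDiagonals m D S) k ≡ S k
  superdiagonal-fromDiagonals (suc m) k k<1+m rewrite size-fromDiagonals m with k ≟ m
  ... | yes refl = update-same (superdiagonal (fromDiagonals m D S)) m (S m)
  ... | no k≢m   = trans (update-other (superdiagonal (fromDiagonals m D S)) m _ k k≢m)
                         (superdiagonal-fromDiagonals m k (NP.≤∧≢⇒< (NP.≤-pred k<1+m) k≢m))

  bandMat-fromDiagonals : ∀ m → bandMat m D S ≋ toMat (fromDiagonals m D S)
  bandMat-fromDiagonals m rewrite size-fromDiagonals m =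
    bandMat-cong m (λ k k≤m → sym (diagonal-fromDiagonals m k k≤m))
                   (λ k k<m → sym (superdiagonal-fromDiagonals m k k<m))

  inner-fromDiagonals : ∀ m → NonzeroExceptLastRow m D S → Inner (fromDiagonals m D S)
  inner-fromDiagonals zero    nz = NonzeroExceptLastRow.firstColumn nz
  inner-fromDiagonals (suc m) nz =
    inner-fromDiagonals m (record { firstColumn = firstColumn
                                  ; row         = λ k → row k ∘ NP.m<n⇒m<1+n
                                  ; column      = λ k → column k ∘ NP.m<n⇒m<1+n }) ,
    subst (λ d → 0 < d + S m) (sym (lastDiag-fromDiagonals m)) (row m NP.≤-refl) ,
    column m NP.≤-refl
    where open NonzeroExceptLastRow nz

bidiagonal⇒toMat : ∀ {n} A → 1 ≤ n → InInt n A → Bidiagonal A →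
                   ∃ λ B → A ≋ toMat B × Proper B × weight B ≡ n
bidiagonal⇒toMat {n} A 1≤n A∈Int bidiag with bidiagonal⇒bandMat A 1≤n A∈Int bidiag
... | m , D , S , A≋bandMat , nz , 0<Dₘ = B , A≋B , properB , weight≡n
  where
  B = fromDiagonals m D S
  A≋B : A ≋ toMat B
  A≋B = ≋-trans A≋bandMat (bandMat-fromDiagonals D S m)
  properB : Proper B
  properB = inner-fromDiagonals D S m nz , subst (0 <_) (sym (lastDiag-fromDiagonals D S m)) 0<Dₘ
  weight≡n : weight B ≡ n
  weight≡n = trans (sym (proj₁ (proj₂ (toMat-InInt B properB))))
                   (trans (sym (entrySum-cong A≋B)) (proj₁ (proj₂ A∈Int)))

-- f read on columns (toMat-remove): the ⟨ s′ ∣ zero ⟩ ⟨ 1 ∣ d ⟩ clause is Rem3, the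
-- ⟨ 0 ∣ 1 ⟩ clause is Rem2, and all others are Rem1.
remove : Band → Band
remove (first d)                     = first (pred d)
remove (B ⟨ suc (suc s) ∣ d ⟩)        = B ⟨ suc s ∣ d ⟩
remove (first d′ ⟨ 1 ∣ d ⟩)           = first d′ ⟨ 0 ∣ d ⟩
remove (B ⟨ s′ ∣ zero ⟩ ⟨ 1 ∣ d ⟩)     = B ⟨ s′ ∣ d ⟩
remove (B ⟨ s′ ∣ suc d′ ⟩ ⟨ 1 ∣ d ⟩)   = B ⟨ s′ ∣ suc d′ ⟩ ⟨ 0 ∣ d ⟩
remove (B ⟨ 0 ∣ 1 ⟩)                 = B
remove (B ⟨ 0 ∣ d ⟩)                 = B ⟨ 0 ∣ pred d ⟩

-- The 0-based row of the topmost positive entry of the last column, i.e. index − 1.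
lastRow : Band → ℕ
lastRow (first _)         = 0
lastRow (B ⟨ zero  ∣ _ ⟩) = suc (size B)
lastRow (B ⟨ suc _ ∣ _ ⟩) = size B

toMat-decrLastDiag₀ : ∀ d → f (toMat (first (suc (suc d)))) ≋ toMat (first (suc d))
toMat-decrLastDiag₀ d =
  ≋-trans (f-bandMat-decrDiag D S 0 d refl refl)
          (bandMat-cong 0 {D = update D 0 (suc d)} {S = S} {D′ = λ _ → suc d}
                          (λ { .0 z≤n → update-same D 0 (suc d) }) (λ _ ()))
  where
  D = diagonal (first (suc (suc d)))
  S = superdiagonal (first (suc (suc d)))

toMat-decrLastDiag : ∀ B d → f (toMat (B ⟨ 0 ∣ suc (suc d) ⟩)) ≋ toMat (B ⟨ 0 ∣ suc d ⟩)
toMat-decrLastDiag B d =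
  ≋-trans (f-bandMat-decrDiag D S (suc p) d (update-same (superdiagonal B) p 0)
                                            (update-same (diagonal B) (suc p) (suc (suc d))))
          (bandMat-cong (suc p) {S = S} (λ k _ → update-update (diagonal B) (suc p) (suc (suc d)) (suc d) k)
                                        (λ _ _ → refl))
  where
  p = size B
  D = diagonal (B ⟨ 0 ∣ suc (suc d) ⟩)
  S = superdiagonal (B ⟨ 0 ∣ suc (suc d) ⟩)

toMat-decrSuper : ∀ B s d → f (toMat (B ⟨ suc (suc s) ∣ d ⟩)) ≋ toMat (B ⟨ suc s ∣ d ⟩)
toMat-decrSuper B s d =
  ≋-trans (f-bandMat-decrSuper D S q s (update-same (superdiagonal B) q (suc (suc s))))
          (bandMat-cong (suc q) {D = D} (λ _ _ → refl)
                                        (λ k _ → update-update (superdiagonal B) q (suc (suc s)) (suc s) k))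
  where
  q = size B
  D = diagonal (B ⟨ suc (suc s) ∣ d ⟩)
  S = superdiagonal (B ⟨ suc (suc s) ∣ d ⟩)

toMat-clearSuper : ∀ B d → 0 < lastDiag B → f (toMat (B ⟨ 1 ∣ d ⟩)) ≋ toMat (B ⟨ 0 ∣ d ⟩)
toMat-clearSuper B d 0<lastDiag =
  ≋-trans (f-bandMat-clearSuper D S q (update-same (superdiagonal B) q 1)
                                (subst (0 <_) (sym (diagonal-penultimate B 1 d)) 0<lastDiag))
          (bandMat-cong (suc q) {D = D} (λ _ _ → refl) (λ k _ → update-update (superdiagonal B) q 1 0 k))
  where
  q = size B
  D = diagonal (B ⟨ 1 ∣ d ⟩)
  S = superdiagonal (B ⟨ 1 ∣ d ⟩)

toMat-merge : ∀ B s d → f (toMat (B ⟨ s ∣ 0 ⟩ ⟨ 1 ∣ d ⟩)) ≋ toMat (B ⟨ s ∣ d ⟩)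
toMat-merge B s d =
  ≋-trans (f-bandMat-merge D S (suc p) (update-same (superdiagonal (B ⟨ s ∣ 0 ⟩)) (suc p) 1)
                           (trans (update-< D₀ (suc (suc p)) d (suc p) NP.≤-refl)
                                  (update-same (diagonal B) (suc p) 0)))
          (bandMat-cong (suc p) merged (update-< (superdiagonal (B ⟨ s ∣ 0 ⟩)) (suc p) 1))
  where
  p = size B
  D₀ = diagonal (B ⟨ s ∣ 0 ⟩)
  D = diagonal (B ⟨ s ∣ 0 ⟩ ⟨ 1 ∣ d ⟩)
  S = superdiagonal (B ⟨ s ∣ 0 ⟩ ⟨ 1 ∣ d ⟩)
  merged : ∀ k → k ≤ suc p → update D (suc p) (D (suc (suc p))) k ≡ update (diagonal B) (suc p) d k
  merged k k≤1+p with k ≟ suc p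
  ... | yes refl = trans (update-same D k _)
                         (trans (update-same D₀ (suc k) d) (sym (update-same (diagonal B) k d)))
  ... | no k≢1+p = trans (update-other D (suc p) _ k k≢1+p)
                   (trans (update-< D₀ (suc (suc p)) d k (s≤s k≤1+p))
                   (trans (update-other (diagonal B) (suc p) 0 k k≢1+p)
                          (sym (update-other (diagonal B) (suc p) d k k≢1+p))))

toMat-dropLast : ∀ B → f (toMat (B ⟨ 0 ∣ 1 ⟩)) ≋ toMat B
toMat-dropLast B =
  ≋-trans (f-bandMat-dropLast D S p (update-same (superdiagonal B) p 0) (update-same (diagonal B) (suc p) 1))
          (bandMat-cong p (λ k k≤p → update-< (diagonal B) (suc p) 1 k (s≤s k≤p))
                          (update-< (superdiagonal B) p 0))
  where
  p = size B
  D = diagonal (B ⟨ 0 ∣ 1 ⟩)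
  S = superdiagonal (B ⟨ 0 ∣ 1 ⟩)

toMat-remove : ∀ B → Proper B → 1 < weight B → f (toMat B) ≋ toMat (remove B)
toMat-remove (first (suc zero))          _                (s≤s ())
toMat-remove (first (suc (suc d)))       _                _ = toMat-decrLastDiag₀ d
toMat-remove (B ⟨ suc (suc s) ∣ d ⟩)      _                _ = toMat-decrSuper B s d
toMat-remove (first d′ ⟨ 1 ∣ d ⟩)         ((0<d′ , _) , _) _ = toMat-clearSuper (first d′) d 0<d′
toMat-remove (B ⟨ s′ ∣ zero ⟩ ⟨ 1 ∣ d ⟩)   _                _ = toMat-merge B s′ d
toMat-remove (B ⟨ s′ ∣ suc d′ ⟩ ⟨ 1 ∣ d ⟩) _                _ =
  toMat-clearSuper (B ⟨ s′ ∣ suc d′ ⟩) d (s≤s z≤n)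
toMat-remove (B ⟨ 0 ∣ 0 ⟩)               (_ , ())         _
toMat-remove (B ⟨ 0 ∣ 1 ⟩)               _                _ = toMat-dropLast B
toMat-remove (B ⟨ 0 ∣ suc (suc d) ⟩)      _                _ = toMat-decrLastDiag B d

indexMinus1-toMat : ∀ B → Proper B → indexMinus1 (toMat B) ≡ lastRow B
indexMinus1-toMat (first d) _ =
  NP.n≤0⇒n≡0 (FP.toℕ≤pred[n] (index0 0 (bandEntries (diagonal (first d)) (superdiagonal (first d)))))
indexMinus1-toMat (B ⟨ suc s ∣ d ⟩) _ =
  trans (cong toℕ (index0-super (diagonal (B ⟨ suc s ∣ d ⟩)) (superdiagonal (B ⟨ suc s ∣ d ⟩)) (size B)
                                (subst (0 <_) (sym (update-same (superdiagonal B) (size B) (suc s))) (s≤s z≤n))))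
        (toℕ-penultimate (size B))
indexMinus1-toMat (B ⟨ zero ∣ d ⟩) (_ , 0<d) =
  trans (cong toℕ (index0-diag (diagonal (B ⟨ zero ∣ d ⟩)) (superdiagonal (B ⟨ zero ∣ d ⟩)) (suc (size B))
                               (update-same (superdiagonal B) (size B) 0)
                               (subst (0 <_) (sym (update-same (diagonal B) (suc (size B)) d)) 0<d)))
        (FP.toℕ-fromℕ (suc (size B)))

Γ-toMat-∷ʳ : ∀ k B → Proper B → weight B ≡ suc (suc k) →
             Γ (suc (suc k)) (toMat B) ≡ Γ (suc k) (toMat (remove B)) ∷ʳ lastRow B
Γ-toMat-∷ʳ k B properB weight≡ =
  cong₂ _∷ʳ_ (Γ-cong (suc k) (toMat-remove B properB (subst (1 <_) (sym weight≡) (s≤s (s≤s z≤n)))))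
             (indexMinus1-toMat B properB)

weight-clear : ∀ B d → weight (B ⟨ 1 ∣ d ⟩) ≡ suc (weight (B ⟨ 0 ∣ d ⟩))
weight-clear B d = shift (weight B) d
  where shift : ∀ w d → w + 1 + d ≡ suc (w + 0 + d)
        shift = solve-∀

weight-merge : ∀ B s d → weight (B ⟨ s ∣ 0 ⟩ ⟨ 1 ∣ d ⟩) ≡ suc (weight (B ⟨ s ∣ d ⟩))
weight-merge B s d = merge (weight B) s d
  where merge : ∀ w s d → w + s + 0 + 1 + d ≡ suc (w + s + d)
        merge = solve-∀

weight-newColumn : ∀ B → weight (B ⟨ 0 ∣ 1 ⟩) ≡ suc (weight B)
weight-newColumn B = newColumn (weight B)
  where newColumn : ∀ w → w + 0 + 1 ≡ suc w
        newColumn = solve-∀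

weight-remove : ∀ B → Proper B → 1 < weight B → weight B ≡ suc (weight (remove B))
weight-remove (first (suc zero))            _ (s≤s ())
weight-remove (first (suc (suc d)))         _ _ = refl
weight-remove (B ⟨ suc (suc s) ∣ d ⟩)        _ _ = cong (_+ d) (NP.+-suc (weight B) (suc s))
weight-remove (first d′ ⟨ 1 ∣ d ⟩)           _ _ = weight-clear (first d′) d
weight-remove (B ⟨ s′ ∣ zero ⟩ ⟨ 1 ∣ d ⟩)     _ _ = weight-merge B s′ d
weight-remove (B ⟨ s′ ∣ suc d′ ⟩ ⟨ 1 ∣ d ⟩)   _ _ = weight-clear (B ⟨ s′ ∣ suc d′ ⟩) d
weight-remove (B ⟨ 0 ∣ 1 ⟩)                 _ _ = weight-newColumn B
weight-remove (B ⟨ 0 ∣ suc (suc d) ⟩)        _ _ = NP.+-suc (weight B + 0) (suc d)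

proper-remove : ∀ B → Proper B → 1 < weight B → Proper (remove B)
proper-remove (first (suc zero))    _ (s≤s ())
proper-remove (first (suc (suc d))) _ _ = s≤s z≤n , s≤s z≤n
proper-remove (B ⟨ suc (suc s) ∣ d ⟩) ((innerB , _ , _) , 0<d) _ =
  (innerB , 0<+ˡ (lastDiag B) (s≤s z≤n) , 0<+ˡ d (s≤s z≤n)) , 0<d
proper-remove (first d′ ⟨ 1 ∣ d ⟩) ((0<d′ , _) , 0<d) _ =
  (0<d′ , 0<+ʳ 0 0<d′ , 0<+ʳ 0 0<d) , 0<d
proper-remove (B ⟨ s′ ∣ zero ⟩ ⟨ 1 ∣ d ⟩) (((innerB , 0<row , _) , _) , 0<d) _ =
  (innerB , 0<row , 0<+ʳ s′ 0<d) , 0<d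
proper-remove (B ⟨ s′ ∣ suc d′ ⟩ ⟨ 1 ∣ d ⟩) ((innerB′ , _) , 0<d) _ =
  (innerB′ , s≤s z≤n , 0<+ʳ 0 0<d) , 0<d
proper-remove (B ⟨ 0 ∣ 1 ⟩) ((innerB , 0<lastDiag+0 , _) , _) _ =
  innerB , subst (0 <_) (NP.+-identityʳ _) 0<lastDiag+0
proper-remove (B ⟨ 0 ∣ suc (suc d) ⟩) ((innerB , 0<row , _) , _) _ =
  (innerB , 0<row , s≤s z≤n) , s≤s z≤n

-- Defs.asc (a ∷ b ∷ r) reduces to ascent a b + asc (b ∷ r).
ascent : ℕ → ℕ → ℕ
ascent a b = if does (a <? b) then 1 else 0

+ascent-< : ∀ m {a b} → a < b → m + ascent a b ≡ suc m
+ascent-< m {a} {b} a<b =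
  trans (cong (λ t → m + (if t then 1 else 0)) (dec-true (a <? b) a<b)) (NP.+-comm m 1)

+ascent-≥ : ∀ m a {b} → b ≤ a → m + ascent a b ≡ m
+ascent-≥ m a {b} b≤a =
  trans (cong (λ t → m + (if t then 1 else 0)) (dec-false (a <? b) (NP.≤⇒≯ b≤a))) (NP.+-identityʳ m)

lastRow-≤ : ∀ B → lastRow B ≤ size B
lastRow-≤ (first _)         = z≤n
lastRow-≤ (B ⟨ zero  ∣ _ ⟩) = NP.≤-refl
lastRow-≤ (B ⟨ suc _ ∣ _ ⟩) = NP.n≤1+n (size B)

size∸1≤lastRow : ∀ B → size B ∸ 1 ≤ lastRow B
size∸1≤lastRow (first _)         = z≤n
size∸1≤lastRow (B ⟨ zero  ∣ _ ⟩) = NP.n≤1+n (size B)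
size∸1≤lastRow (B ⟨ suc _ ∣ _ ⟩) = NP.≤-refl

size-remove : ∀ B → Proper B → 1 < weight B →
              size B ≡ size (remove B) + ascent (lastRow (remove B)) (lastRow B)
size-remove (first (suc zero))             _ (s≤s ())
size-remove (first (suc (suc d)))          _ _ = refl
size-remove (B ⟨ suc (suc s) ∣ d ⟩)         _ _ = sym (+ascent-≥ (suc (size B)) (size B) NP.≤-refl)
size-remove (first d′ ⟨ 1 ∣ d ⟩)            _ _ = refl
size-remove (B ⟨ zero ∣ zero ⟩ ⟨ 1 ∣ d ⟩)    (((_ , _ , ()) , _) , _) _
size-remove (B ⟨ suc s′ ∣ zero ⟩ ⟨ 1 ∣ d ⟩)  _ _ = sym (+ascent-< (suc (size B)) (NP.n<1+n (size B)))
size-remove (B ⟨ s′ ∣ suc d′ ⟩ ⟨ 1 ∣ d ⟩)    _ _ =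
  sym (+ascent-≥ (suc (suc (size B))) (suc (suc (size B))) (NP.n≤1+n (suc (size B))))
size-remove (B ⟨ 0 ∣ 1 ⟩)                  _ _ = sym (+ascent-< (size B) (s≤s (lastRow-≤ B)))
size-remove (B ⟨ 0 ∣ suc (suc d) ⟩)         _ _ = sym (+ascent-≥ (suc (size B)) (suc (size B)) NP.≤-refl)

record Insertion (B : Band) (y : ℕ) : Set where
  field
    extended         : Band
    proper-extended  : Proper extended
    weight-extended  : weight extended ≡ suc (weight B)
    remove-extended  : remove extended ≡ B
    lastRow-extended : lastRow extended ≡ y

insert-column : ∀ B → Proper B → Insertion B (suc (size B))
insert-column B (innerB , 0<lastDiag) = record
  { extended         = B ⟨ 0 ∣ 1 ⟩
  ; proper-extended  = (innerB , 0<+ʳ 0 0<lastDiag , s≤s z≤n) , s≤s z≤n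
  ; weight-extended  = weight-newColumn B
  ; remove-extended  = refl
  ; lastRow-extended = refl
  }

insert-diag : ∀ B → Proper B → Insertion B (size B)
insert-diag (first d) _ = record
  { extended         = first (suc d)
  ; proper-extended  = s≤s z≤n , s≤s z≤n
  ; weight-extended  = refl
  ; remove-extended  = refl
  ; lastRow-extended = refl
  }
insert-diag (C ⟨ zero ∣ zero ⟩) (_ , ())
insert-diag (C ⟨ zero ∣ suc d ⟩) ((innerC , 0<row , _) , _) = record
  { extended         = C ⟨ 0 ∣ suc (suc d) ⟩
  ; proper-extended  = (innerC , 0<row , s≤s z≤n) , s≤s z≤n
  ; weight-extended  = NP.+-suc (weight C + 0) (suc d)
  ; remove-extended  = refl
  ; lastRow-extended = refl
  }
insert-diag (C ⟨ suc s ∣ d ⟩) ((innerC , 0<row , _) , 0<d) = record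
  { extended         = C ⟨ suc s ∣ 0 ⟩ ⟨ 1 ∣ d ⟩
  ; proper-extended  = ((innerC , 0<row , s≤s z≤n) , s≤s z≤n , 0<+ˡ d (s≤s z≤n)) , 0<d
  ; weight-extended  = weight-merge C (suc s) d
  ; remove-extended  = refl
  ; lastRow-extended = refl
  }

remove-clear : ∀ C d → 0 < lastDiag C → remove (C ⟨ 1 ∣ d ⟩) ≡ C ⟨ 0 ∣ d ⟩
remove-clear (first _)        d _ = refl
remove-clear (C ⟨ s ∣ suc _ ⟩) d _ = refl

insert-super : ∀ C s d → Proper (C ⟨ s ∣ d ⟩) → Insertion (C ⟨ s ∣ d ⟩) (size C)
insert-super C zero d ((innerC , 0<lastDiag+0 , _) , 0<d) = record
  { extended         = C ⟨ 1 ∣ d ⟩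
  ; proper-extended  = (innerC , 0<+ˡ (lastDiag C) (s≤s z≤n) , 0<+ˡ d (s≤s z≤n)) , 0<d
  ; weight-extended  = weight-clear C d
  ; remove-extended  = remove-clear C d (subst (0 <_) (NP.+-identityʳ _) 0<lastDiag+0)
  ; lastRow-extended = refl
  }
insert-super C (suc s) d ((innerC , _ , _) , 0<d) = record
  { extended         = C ⟨ suc (suc s) ∣ d ⟩
  ; proper-extended  = (innerC , 0<+ˡ (lastDiag C) (s≤s z≤n) , 0<+ˡ d (s≤s z≤n)) , 0<d
  ; weight-extended  = cong (_+ d) (NP.+-suc (weight C) (suc s))
  ; remove-extended  = refl
  ; lastRow-extended = refl
  }

insertion : ∀ B y → Proper B → size B ∸ 1 ≤ y → y ≤ suc (size B) → Insertion B y
insertion B y properB y≥ y≤ with y ≟ suc (size B) | y ≟ size B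
... | yes refl | _        = insert-column B properB
... | no _     | yes refl = insert-diag B properB
... | no y≢1+m | no y≢m   =
      insert-below B properB y≥ (NP.≤∧≢⇒< (NP.≤-pred (NP.≤∧≢⇒< y≤ y≢1+m)) y≢m)
  where
  insert-below : ∀ B → Proper B → size B ∸ 1 ≤ y → y < size B → Insertion B y
  insert-below (C ⟨ s ∣ d ⟩) properB y≥ y<m rewrite NP.≤-antisym (NP.≤-pred y<m) y≥ =
    insert-super C s d properB

PrefixWise : (List ℕ → ℕ → Set) → List ℕ → Set
PrefixWise P x = ∀ (i : Fin (length x)) → P (take (toℕ i) x) (lookup x i)

prefixWise-∷ʳ⁺ : ∀ {P} xs y → PrefixWise P xs → P xs y → PrefixWise P (xs ∷ʳ y)
prefixWise-∷ʳ⁺         []       y _   Py F.zero    = Py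
prefixWise-∷ʳ⁺         (v ∷ xs) y Pxs Py F.zero    = Pxs F.zero
prefixWise-∷ʳ⁺ {P = P} (v ∷ xs) y Pxs Py (F.suc i) =
  prefixWise-∷ʳ⁺ {P = P ∘ (v ∷_)} xs y (Pxs ∘ F.suc) Py i

prefixWise-∷ʳ⁻ : ∀ {P} xs y → PrefixWise P (xs ∷ʳ y) → PrefixWise P xs × P xs y
prefixWise-∷ʳ⁻         []       y Pxy = (λ ()) , Pxy F.zero
prefixWise-∷ʳ⁻ {P = P} (v ∷ xs) y Pxy with prefixWise-∷ʳ⁻ {P = P ∘ (v ∷_)} xs y (Pxy ∘ F.suc)
... | Pxs , Py = (λ { F.zero → Pxy F.zero ; (F.suc i) → Pxs i }) , Py

length-∷ʳ⁻ : ∀ (xs : List ℕ) y {n} → length (xs ∷ʳ y) ≡ suc n → length xs ≡ n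
length-∷ʳ⁻ xs y length≡ =
  NP.suc-injective (trans (sym (trans (LP.length-++ xs) (NP.+-comm (length xs) 1))) length≡)

last-∷ʳ : ∀ (xs : List ℕ) y → last (xs ∷ʳ y) ≡ just y
last-∷ʳ []           y = refl
last-∷ʳ (a ∷ [])     y = refl
last-∷ʳ (a ∷ b ∷ xs) y = last-∷ʳ (b ∷ xs) y

asc-∷ʳ : ∀ xs {a} y → last xs ≡ just a → asc (xs ∷ʳ y) ≡ asc xs + ascent a y
asc-∷ʳ (b ∷ [])     y refl    = NP.+-comm (ascent b y) 0
asc-∷ʳ (b ∷ c ∷ xs) y last≡a =
  trans (cong (ascent b c +_) (asc-∷ʳ (c ∷ xs) y last≡a)) (sym (NP.+-assoc (ascent b c) _ _))

AscentStep AscentBound : List ℕ → ℕ → Set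
AscentStep  p v = (length p ≡ 0 → v ≡ 0) × (length p ≢ 0 → v ≤ 1 + asc p)
AscentBound p v = asc (p ∷ʳ v) ∸ 1 ≤ v

AscentBounds : List ℕ → Set
AscentBounds x = ∀ (i : Fin (length x)) → ascPrefix (suc (toℕ i)) x ∸ 1 ≤ lookup x i

ascentBounds⇔prefixWise : ∀ x → AscentBounds x ⇔ PrefixWise AscentBound x
ascentBounds⇔prefixWise x = mk⇔
  (λ bounds i → subst (λ p → asc p ∸ 1 ≤ lookup x i) (LP.take-suc x i) (bounds i))
  (λ bounds i → subst (λ p → asc p ∸ 1 ≤ lookup x i) (sym (LP.take-suc x i)) (bounds i))

ascentSequence⇒prefixWise : ∀ {n} x → InAsc n x → PrefixWise AscentStep x
ascentSequence⇒prefixWise x (_ , step) i =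
  subst (λ ℓ → (ℓ ≡ 0 → lookup x i ≡ 0) × (ℓ ≢ 0 → lookup x i ≤ 1 + ascPrefix (toℕ i) x))
        (sym (trans (LP.length-take (toℕ i) x) (NP.m≤n⇒m⊓n≡m (NP.<⇒≤ (FP.toℕ<n i)))))
        (step i)

record Encodes (B : Band) (x : List ℕ) : Set where
  field
    asc≡size     : asc x ≡ size B
    last≡lastRow : last x ≡ just (lastRow B)
    bounded      : PrefixWise AscentBound x

encodes-∷ʳ : ∀ B x → Proper B → 1 < weight B → Encodes (remove B) x → Encodes B (x ∷ʳ lastRow B)
encodes-∷ʳ B x properB 1<weight encodes = record
  { asc≡size     = asc≡size′
  ; last≡lastRow = last-∷ʳ x (lastRow B)
  ; bounded      = prefixWise-∷ʳ⁺ {P = AscentBound} x (lastRow B) bounded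
                     (subst (λ a → a ∸ 1 ≤ lastRow B) (sym asc≡size′) (size∸1≤lastRow B))
  }
  where
  open Encodes encodes
  asc≡size′ : asc (x ∷ʳ lastRow B) ≡ size B
  asc≡size′ = trans (asc-∷ʳ x (lastRow B) last≡lastRow)
    (trans (cong (_+ ascent (lastRow (remove B)) (lastRow B)) asc≡size) (sym (size-remove B properB 1<weight)))

Γ-encodes : ∀ k B → Proper B → weight B ≡ suc k → Encodes B (Γ (suc k) (toMat B))
Γ-encodes zero (first d) _ _ =
  record { asc≡size = refl ; last≡lastRow = refl ; bounded = λ { F.zero → z≤n } }
Γ-encodes zero (B ⟨ s ∣ d ⟩) ((innerB , _) , 0<d) weight≡1 =
  ⊥-elim (NP.<-irrefl (sym weight≡1) (NP.+-mono-≤ (0<+ʳ s (inner⇒0<weight B innerB)) 0<d))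
Γ-encodes (suc k) B properB weight≡ rewrite Γ-toMat-∷ʳ k B properB weight≡ =
  encodes-∷ʳ B _ properB 1<weight
    (Γ-encodes k (remove B) (proper-remove B properB 1<weight)
                 (NP.suc-injective (trans (sym (weight-remove B properB 1<weight)) weight≡)))
  where
  1<weight : 1 < weight B
  1<weight = subst (1 <_) (sym weight≡) (s≤s (s≤s z≤n))

realize : ∀ k x → length x ≡ suc k → PrefixWise AscentStep x → PrefixWise AscentBound x →
          ∃ λ B → Proper B × weight B ≡ suc k × Γ (suc k) (toMat B) ≡ x
realize zero (a ∷ []) _ steps _ =
  first 1 , (s≤s z≤n , s≤s z≤n) , refl , cong [_] (sym (proj₁ (steps F.zero) refl))
realize (suc k) x length≡ steps bounds with initLast x
... | xs ∷ʳ′ y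
    with prefixWise-∷ʳ⁻ {P = AscentStep} xs y steps | prefixWise-∷ʳ⁻ {P = AscentBound} xs y bounds
...   | stepsₓ , stepʸ | boundsₓ , boundʸ with realize k xs (length-∷ʳ⁻ xs y length≡) stepsₓ boundsₓ
...     | B , properB , weightB , Γ≡xs =
          B⁺ , proper-extended , trans weight-extended (cong suc weightB) , Γ≡xs∷ʳy
  where
  open Encodes (subst (Encodes B) Γ≡xs (Γ-encodes k B properB weightB))
  y≤ : y ≤ suc (size B)
  y≤ = subst (λ a → y ≤ suc a) asc≡size
         (proj₂ stepʸ λ length≡0 → NP.0≢1+n (trans (sym length≡0) (length-∷ʳ⁻ xs y length≡)))
  y≥ : size B ∸ 1 ≤ y
  y≥ = NP.≤-trans (NP.∸-monoˡ-≤ 1 (NP.m≤m+n (size B) (ascent (lastRow B) y)))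
         (subst (λ a → a ∸ 1 ≤ y)
                (trans (asc-∷ʳ xs y last≡lastRow) (cong (_+ ascent (lastRow B) y) asc≡size)) boundʸ)
  open Insertion (insertion B y properB y≥ y≤) renaming (extended to B⁺)
  Γ≡xs∷ʳy : Γ (suc (suc k)) (toMat B⁺) ≡ xs ∷ʳ y
  Γ≡xs∷ʳy = trans (Γ-toMat-∷ʳ k B⁺ proper-extended (trans weight-extended (cong suc weightB)))
                  (cong₂ _∷ʳ_ (trans (cong (Γ (suc k) ∘ toMat) remove-extended) Γ≡xs) lastRow-extended)

mainTheorem14 : (n : ℕ) → 1 ≤ n → (x : List ℕ) → InAsc n x →
    (∃ (λ (A : Mat) → InInt n A × Bidiagonal A × Γ n A ≡ x))
      ⇔ (∀ (i : Fin (length x)) → ascPrefix (suc (toℕ i)) x ∸ 1 ≤ lookup x i)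
mainTheorem14 (suc k) 1≤n x x∈Asc@(length≡ , _) = mk⇔ bounded realized
  where
  open Equivalence (ascentBounds⇔prefixWise x)
  bounded : ∃ (λ A → InInt (suc k) A × Bidiagonal A × Γ (suc k) A ≡ x) → AscentBounds x
  bounded (A , A∈Int , bidiag , Γ≡x) with bidiagonal⇒toMat A 1≤n A∈Int bidiag
  ... | B , A≋B , properB , weightB =
    from (subst (PrefixWise AscentBound) (trans (sym (Γ-cong (suc k) A≋B)) Γ≡x)
                (Encodes.bounded (Γ-encodes k B properB weightB)))
  realized : AscentBounds x → ∃ (λ A → InInt (suc k) A × Bidiagonal A × Γ (suc k) A ≡ x)
  realized bounds with realize k x length≡ (ascentSequence⇒prefixWise x x∈Asc) (to bounds)
  ... | B , properB , weightB , Γ≡x =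
    toMat B , subst (λ n → InInt n (toMat B)) weightB (toMat-InInt B properB) ,
    bandMat-bidiagonal (size B) (diagonal B) (superdiagonal B) , Γ≡x
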